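{- For every constant $c>0$ there exists $N_c$ such that whenever $n>N_c$ and $n/c$ is a positive integer, the matrix $R_{n/c}$ is not a principal submatrix of any $n\times n$ skew-conference matrix.
   Context: $R_k$ denotes the $k\times k$ Seidel matrix of the transitive tournament on $k$ teams: the skew-symmetric matrix with all entries above the diagonal equal to $1$, all entries below equal to $-1$, and zero diagonal. A skew-conference matrix of order $n$ is an $n\times n$ skew-symmetric matrix $S$ with entries in $\{0,\pm1\}$ such that $SS^\top=(n-1)I$. -}

module Defs where

open import Data.Nat using (ℕ; zero; suc)
open import Data.Fin using (Fin; zero; suc; _<_; _<?_)
open import Data.Integer using (ℤ; +_; -_; _+_; _*_; 0ℤ; 1ℤ; -1ℤ)
open import Data.Product using (Σ; _×_; ∃)
open import Data.Sum using (_⊎_)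
open import Relation.Binary.PropositionalEquality using (_≡_)
open import Relation.Nullary using (yes; no)

Matrix : ℕ → Set
Matrix n = Fin n → Fin n → ℤ

sumFin : (n : ℕ) → (Fin n → ℤ) → ℤ
sumFin zero    f = 0ℤ
sumFin (suc n) f = f zero + sumFin n (λ i → f (suc i))

δ-scaled : {n : ℕ} → ℤ → Fin n → Fin n → ℤ
δ-scaled a i j with i Data.Fin.≟ j
... | yes _ = a
... | no  _ = 0ℤ

-- Seidel matrix of the transitive tournament on k teams:
-- 1 above the diagonal, -1 below, 0 on the diagonal.
R : (k : ℕ) → Matrix k
R k i j with i <? j
... | yes _ = 1ℤ
... | no _ with j <? i
...   | yes _ = -1ℤ
...   | no _  = 0ℤ

IsSkewConference : (n : ℕ) → Matrix n → Set
IsSkewConference n S =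
  (∀ i j → S j i ≡ - S i j)
  × (∀ i j → (S i j ≡ 0ℤ) ⊎ ((S i j ≡ 1ℤ) ⊎ (S i j ≡ -1ℤ)))
  × (∀ i j → sumFin n (λ l → S i l * S j l) ≡ δ-scaled (+ (n Data.Nat.∸ 1)) i j)

IsPrincipalSubmatrix : (k n : ℕ) → Matrix k → Matrix n → Set
IsPrincipalSubmatrix k n A S =
  Σ (Fin k → Fin n) λ f →
    (∀ i j → i < j → f i < f j) × (∀ i j → S (f i) (f j) ≡ A i j)

{-# OPTIONS --safe #-}
-- Let u be the sum of the k rows of S that carry the copy of R_k. Since S Sᵀ = (n − 1) I,
-- ‖u‖² = k (n − 1). On the k selected coordinates u equals the column sums 2b + 1 − k of R_k,
-- whose squares add up to k (k² − 1) / 3, so k² ≤ 3 (n − 1) + 1. As k = n q / p ≥ n / p, this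
-- forces n ≤ 3 p². Skew-symmetry and the entries of S are never used.
module Submission where

open import Defs
open import Data.Nat.Base using (ℕ; zero; suc)
open import Data.Product using (Σ; ∃; _×_; _,_)
open import Function.Base using (_∘_)
open import Function.Definitions using (Injective)
open import Relation.Binary.PropositionalEquality
  using (_≡_; _≢_; refl; sym; trans; cong; cong₂; subst; subst₂; module ≡-Reasoning)
open import Relation.Nullary using (¬_; contradiction)

module IncreasingMaps where
  open import Data.Fin.Base using (Fin; zero; suc; _<_; punchOut)
  open import Data.Fin.Properties using (<-cmp; <⇒≢; punchIn-punchOut)
  open import Data.Nat.Base using (z<s; s<s; s<s⁻¹)
  open import Data.Nat.Properties using (n≮0)
  open import Relation.Binary.Definitions using (tri<; tri≈; tri>)

  StrictlyIncreasing : ∀ {k n} → (Fin k → Fin n) → Set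
  StrictlyIncreasing f = ∀ i j → i < j → f i < f j

  strictlyIncreasing⇒injective : ∀ {k n} {f : Fin k → Fin n} →
    StrictlyIncreasing f → Injective _≡_ _≡_ f
  strictlyIncreasing⇒injective {f = f} f↑ {a} {b} fa≡fb with <-cmp a b
  ... | tri< a<b _ _ = contradiction fa≡fb (<⇒≢ (f↑ a b a<b))
  ... | tri≈ _ a≡b _ = a≡b
  ... | tri> _ _ b<a = contradiction (sym fa≡fb) (<⇒≢ (f↑ b a b<a))

  avoiding-zero⇒through-suc : ∀ {k n} (f : Fin k → Fin (suc n)) →
    StrictlyIncreasing f → (∀ b → zero ≢ f b) →
    Σ (Fin k → Fin n) λ g → StrictlyIncreasing g × (∀ b → f b ≡ suc (g b))
  avoiding-zero⇒through-suc {k} {n} f f↑ f≢0 = g , g↑ , f≡suc∘g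
    where
    g : Fin k → Fin n
    g b = punchOut (f≢0 b)
    f≡suc∘g : ∀ b → f b ≡ suc (g b)
    f≡suc∘g b = sym (punchIn-punchOut (f≢0 b))
    g↑ : StrictlyIncreasing g
    g↑ i j i<j = s<s⁻¹ (subst₂ _<_ (f≡suc∘g i) (f≡suc∘g j) (f↑ i j i<j))

  strictlyIncreasing-∘suc : ∀ {k n} {f : Fin (suc k) → Fin n} →
    StrictlyIncreasing f → StrictlyIncreasing (f ∘ suc)
  strictlyIncreasing-∘suc f↑ i j i<j = f↑ (suc i) (suc j) (s<s i<j)

  ≢zero-∘suc : ∀ {k n} {f : Fin (suc k) → Fin (suc n)} →
    StrictlyIncreasing f → ∀ b → zero ≢ f (suc b)
  ≢zero-∘suc {f = f} f↑ b 0≡f = n≮0 (subst (f zero <_) (sym 0≡f) (f↑ zero (suc b) z<s))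

module FinSums where
  open import Data.Fin.Base using (Fin; zero; suc)
  open import Data.Fin.Properties using (0≢1+n)
  open import Data.Integer.Base using (ℤ; 0ℤ; +_; _+_; _*_; _≤_)
  open import Data.Integer.Properties
    using ( +-identityˡ; +-monoˡ-≤; +-mono-≤; ≤-refl; ≤-reflexive; ≤-trans
          ; *-comm; *-zeroʳ; *-distribˡ-+; suc-*; +-commutativeSemigroup)
  open import Algebra.Properties.CommutativeSemigroup +-commutativeSemigroup
    using (interchange)
  open IncreasingMaps
  open ≡-Reasoning

  sumFin-cong : ∀ n {f g : Fin n → ℤ} → (∀ i → f i ≡ g i) → sumFin n f ≡ sumFin n g
  sumFin-cong zero    f≗g = refl
  sumFin-cong (suc n) f≗g = cong₂ _+_ (f≗g zero) (sumFin-cong n (f≗g ∘ suc))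

  sumFin-0 : ∀ n → sumFin n (λ _ → 0ℤ) ≡ 0ℤ
  sumFin-0 zero    = refl
  sumFin-0 (suc n) = trans (+-identityˡ _) (sumFin-0 n)

  sumFin-const : ∀ n c → sumFin n (λ _ → c) ≡ + n * c
  sumFin-const zero    c = refl
  sumFin-const (suc n) c = trans (cong (_+_ c) (sumFin-const n c)) (sym (suc-* (+ n) c))

  sumFin-+ : ∀ n (f g : Fin n → ℤ) → sumFin n (λ i → f i + g i) ≡ sumFin n f + sumFin n g
  sumFin-+ zero    f g = refl
  sumFin-+ (suc n) f g = begin
    (f zero + g zero) + sumFin n (λ i → f (suc i) + g (suc i))
      ≡⟨ cong (_+_ (f zero + g zero)) (sumFin-+ n (f ∘ suc) (g ∘ suc)) ⟩
    (f zero + g zero) + (sumFin n (f ∘ suc) + sumFin n (g ∘ suc))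
      ≡⟨ interchange (f zero) (g zero) _ _ ⟩
    sumFin (suc n) f + sumFin (suc n) g ∎

  *-distribˡ-sumFin : ∀ n c (f : Fin n → ℤ) → c * sumFin n f ≡ sumFin n (λ i → c * f i)
  *-distribˡ-sumFin zero    c f = *-zeroʳ c
  *-distribˡ-sumFin (suc n) c f =
    trans (*-distribˡ-+ c (f zero) _) (cong (_+_ (c * f zero)) (*-distribˡ-sumFin n c (f ∘ suc)))

  *-distribʳ-sumFin : ∀ n c (f : Fin n → ℤ) → sumFin n f * c ≡ sumFin n (λ i → f i * c)
  *-distribʳ-sumFin n c f = begin
    sumFin n f * c                 ≡⟨ *-comm (sumFin n f) c ⟩
    c * sumFin n f                 ≡⟨ *-distribˡ-sumFin n c f ⟩
    sumFin n (λ i → c * f i)       ≡⟨ sumFin-cong n (λ i → *-comm c (f i)) ⟩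
    sumFin n (λ i → f i * c)       ∎

  sumFin-*-sumFin : ∀ m n (f : Fin m → ℤ) (g : Fin n → ℤ) →
    sumFin m f * sumFin n g ≡ sumFin m (λ i → sumFin n (λ j → f i * g j))
  sumFin-*-sumFin m n f g =
    trans (*-distribʳ-sumFin m (sumFin n g) f) (sumFin-cong m (λ i → *-distribˡ-sumFin n (f i) g))

  sumFin-comm : ∀ m n (f : Fin m → Fin n → ℤ) →
    sumFin m (λ i → sumFin n (f i)) ≡ sumFin n (λ j → sumFin m (λ i → f i j))
  sumFin-comm zero    n f = sym (sumFin-0 n)
  sumFin-comm (suc m) n f =
    trans (cong (_+_ (sumFin n (f zero))) (sumFin-comm m n (f ∘ suc)))
          (sym (sumFin-+ n (f zero) (λ j → sumFin m (λ i → f (suc i) j))))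

  sumFin-tail-≤ : ∀ n (f : Fin (suc n) → ℤ) → (∀ i → 0ℤ ≤ f i) → sumFin n (f ∘ suc) ≤ sumFin (suc n) f
  sumFin-tail-≤ n f f≥0 = subst (_≤ sumFin (suc n) f) (+-identityˡ _) (+-monoˡ-≤ _ (f≥0 zero))

  sumFin-nonNeg : ∀ n (f : Fin n → ℤ) → (∀ i → 0ℤ ≤ f i) → 0ℤ ≤ sumFin n f
  sumFin-nonNeg zero    f f≥0 = ≤-refl
  sumFin-nonNeg (suc n) f f≥0 = +-mono-≤ (f≥0 zero) (sumFin-nonNeg n (f ∘ suc) (f≥0 ∘ suc))

  sumFin-∘suc-≤ : ∀ n k (g : Fin (suc n) → ℤ) → (∀ l → 0ℤ ≤ g l) →
    (f : Fin k → Fin (suc n)) → StrictlyIncreasing f → (∀ b → zero ≢ f b) →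
    sumFin k (g ∘ f) ≤ sumFin n (g ∘ suc)

  sumFin-∘-≤ : ∀ n k (g : Fin n → ℤ) → (∀ l → 0ℤ ≤ g l) →
    (f : Fin k → Fin n) → StrictlyIncreasing f → sumFin k (g ∘ f) ≤ sumFin n g
  sumFin-∘-≤ n       zero    g g≥0 f f↑ = sumFin-nonNeg n g g≥0
  sumFin-∘-≤ zero    (suc k) g g≥0 f f↑ with () ← f zero
  sumFin-∘-≤ (suc n) (suc k) g g≥0 f f↑ = by-cases (f zero) refl
    where
    by-cases : ∀ x → f zero ≡ x → sumFin (suc k) (g ∘ f) ≤ sumFin (suc n) g
    by-cases zero    f0≡0 = +-mono-≤ (≤-reflexive (cong g f0≡0))
      (sumFin-∘suc-≤ n k g g≥0 (f ∘ suc) (strictlyIncreasing-∘suc f↑) (≢zero-∘suc f↑))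
    by-cases (suc _) f0≡s = ≤-trans (sumFin-∘suc-≤ n (suc k) g g≥0 f f↑ f≢0) (sumFin-tail-≤ n g g≥0)
      where
      f≢0 : ∀ b → zero ≢ f b
      f≢0 zero    0≡f0 = 0≢1+n (trans 0≡f0 f0≡s)
      f≢0 (suc b) = ≢zero-∘suc f↑ b

  sumFin-∘suc-≤ n k g g≥0 f f↑ f≢0 with avoiding-zero⇒through-suc f f↑ f≢0
  ... | h , h↑ , f≡suc∘h = subst (_≤ sumFin n (g ∘ suc)) (sumFin-cong k (cong g ∘ sym ∘ f≡suc∘h))
                             (sumFin-∘-≤ n k (g ∘ suc) (g≥0 ∘ suc) h h↑)

module OrthogonalRows where
  open import Data.Fin.Base using (Fin; zero; suc)
  open import Data.Fin.Properties using (suc-injective; _≟_)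
  open import Data.Integer.Base using (ℤ; 0ℤ; +_; +0; +[1+_]; -[1+_]; _+_; _*_; _≤_; +≤+)
  open import Data.Integer.Properties using (+-identityˡ; +-identityʳ)
  open import Data.Nat.Base using (z≤n)
  open import Relation.Nullary using (yes; no)
  open IncreasingMaps
  open FinSums
  open ≡-Reasoning

  RowsOrthogonal : (n : ℕ) → ℤ → Matrix n → Set
  RowsOrthogonal n c S = ∀ i j → sumFin n (λ l → S i l * S j l) ≡ δ-scaled c i j

  columnSum : ∀ {k} → Matrix k → Fin k → ℤ
  columnSum {k} A b = sumFin k (λ a → A a b)

  sumOfRows : ∀ {k n} → Matrix n → (Fin k → Fin n) → Fin n → ℤ
  sumOfRows {k} S f l = sumFin k (λ a → S (f a) l)

  square : ℤ → ℤ
  square x = x * x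

  square-nonNeg : ∀ x → 0ℤ ≤ square x
  square-nonNeg +0       = +≤+ z≤n
  square-nonNeg +[1+ _ ] = +≤+ z≤n
  square-nonNeg -[1+ _ ] = +≤+ z≤n

  δ-scaled-∘-injective : ∀ {k n} c (f : Fin k → Fin n) → Injective _≡_ _≡_ f →
    ∀ a b → δ-scaled c (f a) (f b) ≡ δ-scaled c a b
  δ-scaled-∘-injective c f f-inj a b with f a ≟ f b | a ≟ b
  ... | yes _     | yes _   = refl
  ... | no  _     | no  _   = refl
  ... | yes fa≡fb | no a≢b  = contradiction (f-inj fa≡fb) a≢b
  ... | no fa≢fb  | yes a≡b = contradiction (cong f a≡b) fa≢fb

  sumFin-δ-scaled : ∀ k c (a : Fin k) → sumFin k (δ-scaled c a) ≡ c
  sumFin-δ-scaled (suc k) c zero    = trans (cong (_+_ c) (sumFin-0 k)) (+-identityʳ c)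
  sumFin-δ-scaled (suc k) c (suc a) = begin
    0ℤ + sumFin k (λ b → δ-scaled c (suc a) (suc b)) ≡⟨ +-identityˡ _ ⟩
    sumFin k (λ b → δ-scaled c (suc a) (suc b))      ≡⟨ sumFin-cong k (δ-scaled-∘-injective c suc suc-injective a) ⟩
    sumFin k (δ-scaled c a)                          ≡⟨ sumFin-δ-scaled k c a ⟩
    c                                                ∎

  sumFin-sumOfRows² : ∀ {k n c} (S : Matrix n) → RowsOrthogonal n c S →
    (f : Fin k → Fin n) → Injective _≡_ _≡_ f →
    sumFin n (λ l → square (sumOfRows S f l)) ≡ + k * c
  sumFin-sumOfRows² {k} {n} {c} S orth f f-inj = begin
    sumFin n (λ l → square (sumOfRows S f l))
      ≡⟨ sumFin-cong n (λ l → sumFin-*-sumFin k k (λ a → S (f a) l) (λ b → S (f b) l)) ⟩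
    sumFin n (λ l → sumFin k (λ a → sumFin k (λ b → S (f a) l * S (f b) l)))
      ≡⟨ sumFin-comm n k _ ⟩
    sumFin k (λ a → sumFin n (λ l → sumFin k (λ b → S (f a) l * S (f b) l)))
      ≡⟨ sumFin-cong k (λ a → sumFin-comm n k _) ⟩
    sumFin k (λ a → sumFin k (λ b → sumFin n (λ l → S (f a) l * S (f b) l)))
      ≡⟨ sumFin-cong k (λ a → sumFin-cong k (λ b → orth (f a) (f b))) ⟩
    sumFin k (λ a → sumFin k (λ b → δ-scaled c (f a) (f b)))
      ≡⟨ sumFin-cong k (λ a → sumFin-cong k (δ-scaled-∘-injective c f f-inj a)) ⟩
    sumFin k (λ a → sumFin k (δ-scaled c a))
      ≡⟨ sumFin-cong k (sumFin-δ-scaled k c) ⟩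
    sumFin k (λ _ → c)
      ≡⟨ sumFin-const k c ⟩
    + k * c ∎

  principalSubmatrix-sumFin-columnSum² : ∀ {k n c} (A : Matrix k) (S : Matrix n) →
    RowsOrthogonal n c S → IsPrincipalSubmatrix k n A S →
    sumFin k (λ b → square (columnSum A b)) ≤ + k * c
  principalSubmatrix-sumFin-columnSum² {k} {n} A S orth (f , f↑ , S∘f≡A) =
    subst₂ _≤_ (sumFin-cong k (λ b → cong square (sumOfRows≡columnSum b)))
               (sumFin-sumOfRows² S orth f (strictlyIncreasing⇒injective f↑))
               (sumFin-∘-≤ n k (square ∘ sumOfRows S f)
                           (square-nonNeg ∘ sumOfRows S f) f f↑)
    where
    sumOfRows≡columnSum : ∀ b → sumOfRows S f (f b) ≡ columnSum A b
    sumOfRows≡columnSum b = sumFin-cong k (λ a → S∘f≡A a b)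

module TransitiveTournament where
  open import Data.Fin.Base using (Fin; zero; suc; toℕ; _<_)
  open import Data.Fin.Properties using (<-asym; <-irrefl; <-cmp; _<?_)
  open import Data.Nat.Base as ℕ using (z≤n; z<s; s<s)
  open import Data.Integer.Base using (ℤ; 0ℤ; 1ℤ; -1ℤ; +_; _+_; _-_; _*_; _≤_)
  open import Data.Integer.Properties
    using (*-distribˡ-+; *-monoˡ-≤-nonNeg; *-cancelˡ-≤-pos; +-monoˡ-≤; pos-+; pos-*; drop‿+≤+; module ≤-Reasoning)
  open import Data.Integer.Tactic.RingSolver using (solve-∀)
  open import Relation.Binary.Definitions using (tri<; tri≈; tri>)
  open import Relation.Nullary using (yes; no)
  open FinSums
  open OrthogonalRows

  R-above : ∀ k {i j : Fin k} → i < j → R k i j ≡ 1ℤ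
  R-above k {i} {j} i<j with i <? j
  ... | yes _   = refl
  ... | no i≮j = contradiction i<j i≮j

  R-below : ∀ k {i j : Fin k} → j < i → R k i j ≡ -1ℤ
  R-below k {i} {j} j<i with i <? j
  ... | yes i<j = contradiction i<j (<-asym j<i)
  ... | no _ with j <? i
  ...   | yes _   = refl
  ...   | no j≮i = contradiction j<i j≮i

  R-diagonal : ∀ k (i : Fin k) → R k i i ≡ 0ℤ
  R-diagonal k i with i <? i
  ... | yes i<i = contradiction i<i (<-irrefl refl)
  ... | no _ with i <? i
  ...   | yes i<i = contradiction i<i (<-irrefl refl)
  ...   | no _    = refl

  R-suc-suc : ∀ k (i j : Fin k) → R (suc k) (suc i) (suc j) ≡ R k i j
  R-suc-suc k i j with <-cmp i j
  ... | tri< i<j _ _    = trans (R-above (suc k) (s<s i<j)) (sym (R-above k i<j))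
  ... | tri≈ _ refl _   = trans (R-diagonal (suc k) (suc i)) (sym (R-diagonal k i))
  ... | tri> _ _ j<i    = trans (R-below (suc k) (s<s j<i)) (sym (R-below k j<i))

  columnSum-R : ∀ k (b : Fin k) → columnSum (R k) b ≡ + 2 * + toℕ b + (1ℤ - + k)
  columnSum-R (suc k) zero = begin
    R (suc k) zero zero + sumFin k (λ a → R (suc k) (suc a) zero)
      ≡⟨ cong₂ _+_ (R-diagonal (suc k) zero) (sumFin-cong k (λ a → R-below (suc k) {suc a} {zero} z<s)) ⟩
    0ℤ + sumFin k (λ _ → -1ℤ)
      ≡⟨ cong (_+_ 0ℤ) (sumFin-const k -1ℤ) ⟩
    0ℤ + + k * -1ℤ
      ≡⟨ first-column (+ k) ⟩
    + 2 * 0ℤ + (1ℤ - (1ℤ + + k)) ∎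
    where
    open ≡-Reasoning
    first-column : ∀ K → 0ℤ + K * -1ℤ ≡ + 2 * 0ℤ + (1ℤ - (1ℤ + K))
    first-column = solve-∀
  columnSum-R (suc k) (suc b) = begin
    R (suc k) zero (suc b) + sumFin k (λ a → R (suc k) (suc a) (suc b))
      ≡⟨ cong₂ _+_ (R-above (suc k) {zero} {suc b} z<s) (sumFin-cong k (λ a → R-suc-suc k a b)) ⟩
    1ℤ + columnSum (R k) b
      ≡⟨ cong (_+_ 1ℤ) (columnSum-R k b) ⟩
    1ℤ + (+ 2 * + toℕ b + (1ℤ - + k))
      ≡⟨ later-column (+ toℕ b) (+ k) ⟩
    + 2 * (1ℤ + + toℕ b) + (1ℤ - (1ℤ + + k)) ∎
    where
    open ≡-Reasoning
    later-column : ∀ B K → 1ℤ + (+ 2 * B + (1ℤ - K)) ≡ + 2 * (1ℤ + B) + (1ℤ - (1ℤ + K))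
    later-column = solve-∀

  sumFin-progression² : ∀ k t →
    + 3 * sumFin k (λ b → square (+ 2 * + toℕ b + t))
      ≡ + k * (+ 2 * (+ k - 1ℤ) * (+ 2 * + k - 1ℤ) + + 6 * t * (+ k - 1ℤ) + + 3 * t * t)
  sumFin-progression² zero    t = refl
  sumFin-progression² (suc k) t = begin
    + 3 * (square t′ + sumFin k (λ b → square (+ 2 * (1ℤ + + toℕ b) + t)))
      ≡⟨ cong (λ s → + 3 * (square t′ + s)) (sumFin-cong k (λ b → cong square (shift (+ toℕ b) t))) ⟩
    + 3 * (square t′ + sumFin k (λ b → square (+ 2 * + toℕ b + (t + + 2))))
      ≡⟨ *-distribˡ-+ (+ 3) (square t′) _ ⟩
    + 3 * square t′ + + 3 * sumFin k (λ b → square (+ 2 * + toℕ b + (t + + 2)))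
      ≡⟨ cong (_+_ (+ 3 * square t′)) (sumFin-progression² k (t + + 2)) ⟩
    + 3 * square t′ + + k * (+ 2 * (+ k - 1ℤ) * (+ 2 * + k - 1ℤ) + + 6 * (t + + 2) * (+ k - 1ℤ) + + 3 * (t + + 2) * (t + + 2))
      ≡⟨ peel-first (+ k) t ⟩
    (1ℤ + + k) * (+ 2 * (1ℤ + + k - 1ℤ) * (+ 2 * (1ℤ + + k) - 1ℤ) + + 6 * t * (1ℤ + + k - 1ℤ) + + 3 * t * t) ∎
    where
    open ≡-Reasoning
    t′ : ℤ
    t′ = + 2 * 0ℤ + t
    shift : ∀ B t → + 2 * (1ℤ + B) + t ≡ + 2 * B + (t + + 2)
    shift = solve-∀
    peel-first : ∀ K t →
      + 3 * ((+ 2 * 0ℤ + t) * (+ 2 * 0ℤ + t))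
        + K * (+ 2 * (K - 1ℤ) * (+ 2 * K - 1ℤ) + + 6 * (t + + 2) * (K - 1ℤ) + + 3 * (t + + 2) * (t + + 2))
      ≡ (1ℤ + K) * (+ 2 * (1ℤ + K - 1ℤ) * (+ 2 * (1ℤ + K) - 1ℤ) + + 6 * t * (1ℤ + K - 1ℤ) + + 3 * t * t)
    peel-first = solve-∀

  sumFin-columnSum-R² : ∀ k → + 3 * sumFin k (λ b → square (columnSum (R k) b)) ≡ + k * (+ k * + k - 1ℤ)
  sumFin-columnSum-R² k = begin
    + 3 * sumFin k (λ b → square (columnSum (R k) b))
      ≡⟨ cong (_*_ (+ 3)) (sumFin-cong k (λ b → cong square (columnSum-R k b))) ⟩
    + 3 * sumFin k (λ b → square (+ 2 * + toℕ b + (1ℤ - + k)))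
      ≡⟨ sumFin-progression² k (1ℤ - + k) ⟩
    + k * (+ 2 * (+ k - 1ℤ) * (+ 2 * + k - 1ℤ) + + 6 * (1ℤ - + k) * (+ k - 1ℤ) + + 3 * (1ℤ - + k) * (1ℤ - + k))
      ≡⟨ cong (_*_ (+ k)) (centred (+ k)) ⟩
    + k * (+ k * + k - 1ℤ) ∎
    where
    open ≡-Reasoning
    centred : ∀ K → + 2 * (K - 1ℤ) * (+ 2 * K - 1ℤ) + + 6 * (1ℤ - K) * (K - 1ℤ) + + 3 * (1ℤ - K) * (1ℤ - K) ≡ K * K - 1ℤ
    centred = solve-∀

  R-principal⇒k²≤3c+1 : ∀ {k n c} (S : Matrix n) → RowsOrthogonal n c S →
    IsPrincipalSubmatrix (suc k) n (R (suc k)) S → + suc k * + suc k ≤ + 3 * c + 1ℤ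
  R-principal⇒k²≤3c+1 {k} {n} {c} S orth sub = *-cancelˡ-≤-pos _ _ K (begin
    K * (K * K)                                           ≡⟨ split-cube K ⟩
    K * (K * K - 1ℤ) + K                                  ≡⟨ cong (λ x → x + K) (sym (sumFin-columnSum-R² (suc k))) ⟩
    + 3 * sumFin (suc k) (λ b → square (columnSum R′ b)) + K
      ≤⟨ +-monoˡ-≤ K (*-monoˡ-≤-nonNeg (+ 3) (principalSubmatrix-sumFin-columnSum² R′ S orth sub)) ⟩
    + 3 * (K * c) + K                                     ≡⟨ factor K c ⟩
    K * (+ 3 * c + 1ℤ)                                    ∎)
    where
    open ≤-Reasoning
    K : ℤ
    K = + suc k
    R′ : Matrix (suc k)
    R′ = R (suc k)
    split-cube : ∀ K → K * (K * K) ≡ K * (K * K - 1ℤ) + K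
    split-cube = solve-∀
    factor : ∀ K c → + 3 * (K * c) + K ≡ K * (+ 3 * c + 1ℤ)
    factor = solve-∀

  skewConference-R-principal⇒k²≤3[n∸1]+1 : ∀ {k n} (S : Matrix n) → IsSkewConference n S →
    IsPrincipalSubmatrix k n (R k) S → k ℕ.* k ℕ.≤ 3 ℕ.* (n ℕ.∸ 1) ℕ.+ 1
  skewConference-R-principal⇒k²≤3[n∸1]+1 {zero}      S _             _   = z≤n
  skewConference-R-principal⇒k²≤3[n∸1]+1 {suc k} {n} S (_ , _ , orth) sub =
    drop‿+≤+ (subst₂ _≤_ (sym (pos-* (suc k) (suc k))) (sym 3c+1-homo) (R-principal⇒k²≤3c+1 S orth sub))
    where
    3c+1-homo : + (3 ℕ.* (n ℕ.∸ 1) ℕ.+ 1) ≡ + 3 * + (n ℕ.∸ 1) + 1ℤ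
    3c+1-homo = trans (pos-+ (3 ℕ.* (n ℕ.∸ 1)) 1) (cong (λ x → x + 1ℤ) (pos-* 3 (n ℕ.∸ 1)))

open import Data.Nat using (_<_; _*_; _+_; _∸_; _≤_; z≤n; s≤s; z<s)
open import Data.Nat.Properties
  using (*-mono-≤; *-monoˡ-≤; *-cancelˡ-≤; +-monoʳ-≤; m≤m*n; <⇒≱; module ≤-Reasoning)
open import Data.Nat.Tactic.RingSolver using (solve-∀)
open TransitiveTournament using (skewConference-R-principal⇒k²≤3[n∸1]+1)

nq≡kp⇒n≤3p² : ∀ {n k p q} → 0 < q → n * q ≡ k * p → k * k ≤ 3 * (n ∸ 1) + 1 → n ≤ 3 * (p * p)
nq≡kp⇒n≤3p² {zero}                _   _     _   = z≤n
nq≡kp⇒n≤3p² {suc m} {k} {p} {q} z<s nq≡kp k²≤ = *-cancelˡ-≤ (suc m) (begin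
  suc m * suc m               ≤⟨ *-mono-≤ (m≤m*n (suc m) q) (m≤m*n (suc m) q) ⟩
  (suc m * q) * (suc m * q)   ≡⟨ cong (λ x → x * x) nq≡kp ⟩
  (k * p) * (k * p)           ≡⟨ regroup k p ⟩
  (k * k) * (p * p)           ≤⟨ *-monoˡ-≤ (p * p) k²≤ ⟩
  (3 * m + 1) * (p * p)       ≤⟨ *-monoˡ-≤ (p * p) (+-monoʳ-≤ (3 * m) (s≤s z≤n)) ⟩
  (3 * m + 3) * (p * p)       ≡⟨ factor m (p * p) ⟩
  suc m * (3 * (p * p))       ∎)
  where
  open ≤-Reasoning
  regroup : ∀ k p → (k * p) * (k * p) ≡ (k * k) * (p * p)
  regroup = solve-∀
  factor : ∀ m x → (3 * m + 3) * x ≡ (1 + m) * (3 * x)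
  factor = solve-∀

proposition7p5 : (p q : ℕ) → 0 < p → 0 < q →
    ∃ λ N → (n k : ℕ) → N < n → 0 < k → n * q ≡ k * p →
      (S : Matrix n) → IsSkewConference n S →
        ¬ IsPrincipalSubmatrix k n (R k) S
proposition7p5 p q _ q>0 = 3 * (p * p) , λ n k N<n _ nq≡kp S S-conf R⊆S →
  <⇒≱ N<n (nq≡kp⇒n≤3p² {n} {k} {p} q>0 nq≡kp (skewConference-R-principal⇒k²≤3[n∸1]+1 S S-conf R⊆S))
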